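{- For every $n\ge 2$, the subgroup $\mathbf{O}_C$ of the $n\times n\times n$ Rubik's Cube group $\mathbf{G}$ consisting of the elements that leave every cubie in its position and fix every sticker not lying on a corner cubie (so that they only change corner orientations) is isomorphic to $\mathbb{Z}_3^7$.
   Context: The $n\times n\times n$ Rubik's Cube has faces U, D, F, B, R, L, each an $n\times n$ grid of facelets carrying stickers ($6n^2$ in total). For $1\le k\le\lfloor n/2\rfloor$, $F_k,B_k,R_k,L_k,U_k,D_k$ denote clockwise (seen from the named face) $90^\circ$ rotations of the $k$-th $n\times n\times 1$ slice counted from the named face. $\mathbf{G}$ is the subgroup of the symmetric group on the facelets generated by the facelet permutations induced by these moves. Corner cubies are the 8 cubies with three stickers; each can be rotated in place among 3 orientations (elements of $\mathbb{Z}_3$). -}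

module Defs where

open import Data.Nat as ℕ using (ℕ; _≤_; _∸_)
open import Data.Integer as ℤ using (ℤ; +_; -_; _-_)
open import Data.Fin using (Fin; zero; suc; toℕ)
open import Data.Vec using (Vec; zipWith)
open import Data.Bool using (if_then_else_)
open import Data.Product using (Σ; _×_; _,_; proj₁)
open import Relation.Nullary using (¬_; does)
open import Relation.Binary.PropositionalEquality using (_≡_)

-- We use "doubled" coordinates: the cube is [-n, n]^3; cubie centres
-- have coordinates in {-(n-1), -(n-3), …, n-1}; a sticker (facelet)
-- lies at the point where its cubie touches the boundary, i.e. one
-- coordinate is ±n and the other two are cubie-centre coordinates.

record V3 : Set where
  constructor v3
  field
    x y z : ℤ
open V3 public

data Axis : Set where
  X Y Z : Axis

data Sign : Set where
  pos neg : Sign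

coord : Axis → V3 → ℤ
coord X p = x p
coord Y p = y p
coord Z p = z p

signed : Sign → ℤ → ℤ
signed pos v = v
signed neg v = - v

grid : (n : ℕ) → Fin n → ℤ
grid n i = (+ (2 ℕ.* toℕ i)) - (+ (n ∸ 1))

Face : Set
Face = Axis × Sign

Facelet : ℕ → Set
Facelet n = Face × Fin n × Fin n

posF : (n : ℕ) → Facelet n → V3
posF n ((X , s) , i , j) = v3 (signed s (+ n)) (grid n i) (grid n j)
posF n ((Y , s) , i , j) = v3 (grid n i) (signed s (+ n)) (grid n j)
posF n ((Z , s) , i , j) = v3 (grid n i) (grid n j) (signed s (+ n))

clamp : ℕ → ℤ → ℤ
clamp n v =
  if does ((+ n) ℤ.≤? v) then + (n ∸ 1)
  else if does (v ℤ.≤? (- (+ n))) then - (+ (n ∸ 1))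
  else v

cubie : ℕ → V3 → V3
cubie n p = v3 (clamp n (x p)) (clamp n (y p)) (clamp n (z p))

IsCorner : ℕ → V3 → Set
IsCorner n c = (ℤ.∣ x c ∣ ≡ n ∸ 1) × (ℤ.∣ y c ∣ ≡ n ∸ 1) × (ℤ.∣ z c ∣ ≡ n ∸ 1)

rot : Axis → V3 → V3
rot X (v3 a b c) = v3 a (- c) b
rot Y (v3 a b c) = v3 c b (- a)
rot Z (v3 a b c) = v3 (- b) a c

rot⁻¹ : Axis → V3 → V3
rot⁻¹ a p = rot a (rot a (rot a p))

-- Moves: the k-th slice from face (a , s), 1 ≤ k ≤ ⌊n/2⌋, turned
-- clockwise as seen from that face (inv = false) or its inverse
-- (inv = true; included so that the generated monoid is the generated group).

record Move (n : ℕ) : Set where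
  constructor mv
  field
    axis  : Axis
    side  : Sign
    k     : ℕ
    k≥1   : 1 ≤ k
    2k≤n  : 2 ℕ.* k ≤ n
    inv   : Data.Bool.Bool

sliceCoord : ℕ → Sign → ℕ → ℤ
sliceCoord n s k = signed s ((+ (n ℕ.+ 1)) - (+ (2 ℕ.* k)))

-- clockwise seen from the +side face is a -90° rotation about the axis,
-- clockwise seen from the -side face is a +90° rotation.
turn : Axis → Sign → Data.Bool.Bool → V3 → V3
turn a pos Data.Bool.false = rot⁻¹ a
turn a pos Data.Bool.true  = rot a
turn a neg Data.Bool.false = rot a
turn a neg Data.Bool.true  = rot⁻¹ a

applyMove : (n : ℕ) → Move n → V3 → V3
applyMove n (mv a s k _ _ b) p =
  if does (clamp n (coord a p) ℤ.≟ sliceCoord n s k) then turn a s b p else p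

-- The cube group G: words in the generators (and their inverses), acting
-- on facelets; two words are the same element iff they induce the same
-- permutation of the facelets.

infixl 7 _·_
data Word (n : ℕ) : Set where
  ε   : Word n
  gen : Move n → Word n
  _·_ : Word n → Word n → Word n

-- u · v : first perform u, then v
eval : (n : ℕ) → Word n → V3 → V3
eval n ε p = p
eval n (gen m) p = applyMove n m p
eval n (u · v) p = eval n v (eval n u p)

_≈G_ : {n : ℕ} → Word n → Word n → Set
_≈G_ {n} u v = (f : Facelet n) → eval n u (posF n f) ≡ eval n v (posF n f)

InOC : (n : ℕ) → Word n → Set
InOC n w =
  ((f : Facelet n) → cubie n (eval n w (posF n f)) ≡ cubie n (posF n f)) ×
  ((f : Facelet n) → ¬ IsCorner n (cubie n (posF n f)) → eval n w (posF n f) ≡ posF n f)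

OC : ℕ → Set
OC n = Σ (Word n) (InOC n)

_+₃_ : Fin 3 → Fin 3 → Fin 3
zero +₃ b = b
suc zero +₃ zero = suc zero
suc zero +₃ suc zero = suc (suc zero)
suc zero +₃ suc (suc zero) = zero
suc (suc zero) +₃ zero = suc (suc zero)
suc (suc zero) +₃ suc zero = zero
suc (suc zero) +₃ suc (suc zero) = suc zero

Z3^7 : Set
Z3^7 = Vec (Fin 3) 7

_⊕_ : Z3^7 → Z3^7 → Z3^7
_⊕_ = zipWith _+₃_

-- Group isomorphism O_C ≅ Z₃^7 (O_C with the group law of G; the
-- homomorphism condition is stated for any membership proof of the product).

record OC≅Z3^7 (n : ℕ) : Set where
  field
    to      : OC n → Z3^7
    from    : Z3^7 → OC n
    to-cong : (g h : OC n) → proj₁ g ≈G proj₁ h → to g ≡ to h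
    to-hom  : (g h : OC n) (p : InOC n (proj₁ g · proj₁ h)) →
              to (proj₁ g · proj₁ h , p) ≡ to g ⊕ to h
    from-to : (g : OC n) → proj₁ (from (to g)) ≈G proj₁ g
    to-from : (v : Z3^7) → to (from v) ≡ v

-- Only outer-layer turns move corner stickers, and on the 24 corner stickers they commute with
-- the cyclic rotation of the three stickers of each corner. Hence the action of a cube element on
-- the corners is determined by its corner permutation together with one twist in Z₃ per corner,
-- and every face turn keeps the sum of the eight twists equal to 0. An element of O_C fixes the
-- corner positions, so its twists form a homomorphism into the sum-zero subgroup of Z₃⁸, which is
-- Z₃⁷ after forgetting the last corner; it is injective because such an element fixes all other
-- stickers. Conjugates of the commutator [(R'D'RD)², U] twist each of the first seven corners
-- against the last one and fix every other sticker, which gives surjectivity. To handle all n at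
-- once, stickers are described symbolically: each coordinate is ±n, ±(n-1), or one of two unknown
-- inner grid coordinates, and outer turns act on these descriptions uniformly in n.

module Submission where

open import Defs
open import Algebra.Bundles using (CommutativeMonoid)
import Algebra.Properties.CommutativeMonoid.Sum as CommutativeMonoidSum
open import Data.Bool as Bool using (Bool; true; false; T; not; _∧_; _∨_; if_then_else_)
import Data.Bool.Properties as Boolₚ
open import Data.Fin as Fin using (Fin; zero; suc; toℕ; fromℕ; inject₁; lower₁)
import Data.Fin.Properties as Finₚ
open import Data.Fin.Permutation using (permutation)
open import Data.Fin.Patterns using (0F; 1F; 2F; 3F; 4F; 5F; 6F; 7F)
open import Data.Integer as ℤ using (ℤ; +_; -[1+_]; -_; ∣_∣; +≤+; -≤-)
import Data.Integer.Properties as ℤₚ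
open import Data.List using (List; []; _∷_; _++_; foldl; reverse; map)
import Data.List.Properties as Listₚ
open import Data.Nat as ℕ using (ℕ; zero; suc; _≤_; _<_; z≤n; s≤s)
import Data.Nat.Properties as ℕₚ
open import Data.Product using (_×_; _,_; proj₁; proj₂)
import Data.Product.Properties as Productₚ
open import Data.Sum using (inj₁; inj₂)
open import Data.Empty using (⊥-elim)
open import Data.Unit using (tt)
open import Data.Vec using (_∷_; tabulate; lookup; zipWith)
import Data.Vec.Properties as Vecₚ
open import Data.Vec.Functional using (Vector; init; last)
import Data.Vec.Functional as Vector
open import Function using (_∘_; id; Equivalence)
open import Relation.Binary using (DecidableEquality)
open import Relation.Binary.PropositionalEquality
open import Relation.Nullary using (¬_; Dec; yes; no; does; map′; _×-dec_; _→-dec_)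
open import Relation.Nullary.Decidable using (from-yes; dec-true; dec-false; T?)
import Relation.Unary as Unary

open ≡-Reasoning

Exhaustible : Set → Set₁
Exhaustible A = ∀ {P : A → Set} → Unary.Decidable P → Dec (∀ x → P x)

∀-Bool? : Exhaustible Bool
∀-Bool? P? = map′ (λ (p , q) → λ { false → p ; true → q }) (λ f → f false , f true)
                  (P? false ×-dec P? true)

∀-Sign? : Exhaustible Sign
∀-Sign? P? = map′ (λ (p , q) → λ { pos → p ; neg → q }) (λ f → f pos , f neg)
                  (P? pos ×-dec P? neg)

∀-Axis? : Exhaustible Axis
∀-Axis? P? = map′ (λ (p , q , r) → λ { X → p ; Y → q ; Z → r }) (λ f → f X , f Y , f Z)
                  (P? X ×-dec P? Y ×-dec P? Z)

∀-Fin? : ∀ {k} → Exhaustible (Fin k)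
∀-Fin? = Finₚ.all?

∀-×? : ∀ {A B : Set} → Exhaustible A → Exhaustible B → Exhaustible (A × B)
∀-×? ∀A? ∀B? P? = map′ (λ f (a , b) → f a b) (λ f a b → f (a , b))
                       (∀A? λ a → ∀B? λ b → P? (a , b))

_≟ₛ_ : DecidableEquality Sign
pos ≟ₛ pos = yes refl
neg ≟ₛ neg = yes refl
pos ≟ₛ neg = no λ ()
neg ≟ₛ pos = no λ ()

_≟ₐ_ : DecidableEquality Axis
X ≟ₐ X = yes refl
Y ≟ₐ Y = yes refl
Z ≟ₐ Z = yes refl
X ≟ₐ Y = no λ ()
X ≟ₐ Z = no λ ()
Y ≟ₐ X = no λ ()
Y ≟ₐ Z = no λ ()
Z ≟ₐ X = no λ ()
Z ≟ₐ Y = no λ ()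

+₃-identityʳ : ∀ a → a +₃ zero ≡ a
+₃-identityʳ = from-yes (∀-Fin? λ a → a +₃ zero Finₚ.≟ a)

+₃-comm : ∀ a b → a +₃ b ≡ b +₃ a
+₃-comm = from-yes (∀-Fin? λ a → ∀-Fin? λ b → a +₃ b Finₚ.≟ b +₃ a)

+₃-assoc : ∀ a b c → (a +₃ b) +₃ c ≡ a +₃ (b +₃ c)
+₃-assoc = from-yes (∀-Fin? λ a → ∀-Fin? λ b → ∀-Fin? λ c →
                       (a +₃ b) +₃ c Finₚ.≟ a +₃ (b +₃ c))

+₃-cancelˡ : ∀ a b c → a +₃ b ≡ a +₃ c → b ≡ c
+₃-cancelˡ = from-yes (∀-Fin? λ a → ∀-Fin? λ b → ∀-Fin? λ c →
                         (a +₃ b Finₚ.≟ a +₃ c) →-dec (b Finₚ.≟ c))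

ℤ₃ : CommutativeMonoid _ _
ℤ₃ = record
  { Carrier = Fin 3
  ; _≈_ = _≡_
  ; _∙_ = _+₃_
  ; ε = zero
  ; isCommutativeMonoid = record
    { isMonoid = record
      { isSemigroup = record
        { isMagma = record { isEquivalence = isEquivalence ; ∙-cong = cong₂ _+₃_ }
        ; assoc = +₃-assoc }
      ; identity = (λ _ → refl) , +₃-identityʳ }
    ; comm = +₃-comm } }

open CommutativeMonoidSum ℤ₃
  using (sum; sum-cong-≗; sum-permute; sum-init-last; sum-replicate-zero; ∑-distrib-+)

sum-δ : ∀ {k} (j : Fin k) (v : Vector (Fin 3) k) →
        sum (λ i → if does (i Fin.≟ j) then v i else zero) ≡ v j
sum-δ {suc k} zero v = trans (cong (v zero +₃_) (sum-replicate-zero k)) (+₃-identityʳ (v zero))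
sum-δ (suc j) v = sum-δ j (v ∘ suc)

init-sum-≗ : ∀ {k} (s t : Vector (Fin 3) (suc k)) → init s ≗ init t → sum s ≡ sum t → s ≗ t
init-sum-≗ {k} s t init≗ sum≡ j with toℕ j ℕ.≟ k
... | yes j≡k = begin
  s j         ≡⟨ cong s j≡last ⟩
  last s      ≡⟨ last≡ ⟩
  last t      ≡⟨ cong t j≡last ⟨
  t j         ∎
  where
  j≡last : j ≡ fromℕ k
  j≡last = Finₚ.toℕ-injective (trans j≡k (sym (Finₚ.toℕ-fromℕ k)))
  last≡ : last s ≡ last t
  last≡ = +₃-cancelˡ (sum (init t)) (last s) (last t) (begin
    sum (init t) +₃ last s  ≡⟨ cong (_+₃ last s) (sum-cong-≗ init≗) ⟨
    sum (init s) +₃ last s  ≡⟨ sum-init-last s ⟨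
    sum s                   ≡⟨ sum≡ ⟩
    sum t                   ≡⟨ sum-init-last t ⟩
    sum (init t) +₃ last t  ∎)
... | no j≢k = begin
  s j                     ≡⟨ cong s (Finₚ.inject₁-lower₁ j (j≢k ∘ sym)) ⟨
  init s (lower₁ j _)     ≡⟨ init≗ _ ⟩
  init t (lower₁ j _)     ≡⟨ cong t (Finₚ.inject₁-lower₁ j (j≢k ∘ sym)) ⟩
  t j                     ∎

zipWith-tabulate : ∀ {A B C : Set} {k} (f : A → B → C) (g : Fin k → A) (h : Fin k → B) →
                   zipWith f (tabulate g) (tabulate h) ≡ tabulate (λ i → f (g i) (h i))
zipWith-tabulate {k = zero}  f g h = refl
zipWith-tabulate {k = suc k} f g h =
  cong (f (g zero) (h zero) ∷_) (zipWith-tabulate f (g ∘ suc) (h ∘ suc))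

flip : Sign → Sign
flip pos = neg
flip neg = pos

-- A coordinate of a sticker is ±n (face), ±(n-1) (edge), or a grid coordinate strictly
-- inside (-(n-1), n-1), kept as one of two unknowns.
data Level : Set where
  face edge : Level
  inner     : Bool → Level

_≟ₗ_ : DecidableEquality Level
face    ≟ₗ face    = yes refl
edge    ≟ₗ edge    = yes refl
inner a ≟ₗ inner b = map′ (cong inner) (λ { refl → refl }) (a Bool.≟ b)
face    ≟ₗ edge    = no λ ()
face    ≟ₗ inner _ = no λ ()
edge    ≟ₗ face    = no λ ()
edge    ≟ₗ inner _ = no λ ()
inner _ ≟ₗ face    = no λ ()
inner _ ≟ₗ edge    = no λ ()

SymCoord : Set
SymCoord = Sign × Level

SymPoint : Set
SymPoint = SymCoord × SymCoord × SymCoord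

_≟ᶜ_ : DecidableEquality SymCoord
_≟ᶜ_ = Productₚ.≡-dec _≟ₛ_ _≟ₗ_

_≟ᵖ_ : DecidableEquality SymPoint
_≟ᵖ_ = Productₚ.≡-dec _≟ᶜ_ (Productₚ.≡-dec _≟ᶜ_ _≟ᶜ_)

negᶜ : SymCoord → SymCoord
negᶜ (σ , l) = flip σ , l

coordˢ : Axis → SymPoint → SymCoord
coordˢ X (cx , _ , _) = cx
coordˢ Y (_ , cy , _) = cy
coordˢ Z (_ , _ , cz) = cz

symRot : Axis → SymPoint → SymPoint
symRot X (cx , cy , cz) = cx , negᶜ cz , cy
symRot Y (cx , cy , cz) = cz , cy , negᶜ cx
symRot Z (cx , cy , cz) = negᶜ cy , cx , cz

symRot⁻¹ : Axis → SymPoint → SymPoint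
symRot⁻¹ a = symRot a ∘ symRot a ∘ symRot a

symTurn : Axis → Sign → Bool → SymPoint → SymPoint
symTurn a pos false = symRot⁻¹ a
symTurn a pos true  = symRot a
symTurn a neg false = symRot a
symTurn a neg true  = symRot⁻¹ a

-- A quarter turn of the outer layer at the face (a , s), clockwise when the flag is false.
OuterMove : Set
OuterMove = Axis × Sign × Bool

inverse : OuterMove → OuterMove
inverse (a , s , b) = a , s , not b

inOuterLayer : Sign → SymCoord → Bool
inOuterLayer s (σ , face)    = does (σ ≟ₛ s)
inOuterLayer s (σ , edge)    = does (σ ≟ₛ s)
inOuterLayer s (σ , inner _) = false

symMove : OuterMove → SymPoint → SymPoint
symMove (a , s , b) p = if inOuterLayer s (coordˢ a p) then symTurn a s b p else p

run : {A : Set} → (OuterMove → A → A) → List OuterMove → A → A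
run act l a = foldl (λ p f → act f p) a l

run-++ : {A : Set} (act : OuterMove → A → A) (l l′ : List OuterMove) (a : A) →
         run act (l ++ l′) a ≡ run act l′ (run act l a)
run-++ act l l′ a = Listₚ.foldl-++ (λ p f → act f p) a l l′

isInner : SymCoord → Bool
isInner (_ , inner _) = true
isInner (_ , face)    = false
isInner (_ , edge)    = false

hasInner : SymPoint → Bool
hasInner (cx , cy , cz) = isInner cx ∨ isInner cy ∨ isInner cz

clampᶜ : SymCoord → SymCoord
clampᶜ (σ , face) = σ , edge
clampᶜ c          = c

clampˢ : SymPoint → SymPoint
clampˢ (cx , cy , cz) = clampᶜ cx , clampᶜ cy , clampᶜ cz

Corner : Set
Corner = Sign × Sign × Sign

-- The sticker of a corner lying on the face orthogonal to the given axis.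
CornerSticker : Set
CornerSticker = Corner × Axis

cnr : CornerSticker → Corner
cnr = proj₁

_≟ᵏ_ : DecidableEquality Corner
_≟ᵏ_ = Productₚ.≡-dec _≟ₛ_ (Productₚ.≡-dec _≟ₛ_ _≟ₛ_)

_≟ᵗ_ : DecidableEquality CornerSticker
_≟ᵗ_ = Productₚ.≡-dec _≟ᵏ_ _≟ₐ_

∀-Corner? : Exhaustible Corner
∀-Corner? = ∀-×? ∀-Sign? (∀-×? ∀-Sign? ∀-Sign?)

∀-CornerSticker? : Exhaustible CornerSticker
∀-CornerSticker? = ∀-×? ∀-Corner? ∀-Axis?

∀-OuterMove? : Exhaustible OuterMove
∀-OuterMove? = ∀-×? ∀-Axis? (∀-×? ∀-Sign? ∀-Bool?)

cornerSign : Axis → Corner → Sign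
cornerSign X (sx , _ , _) = sx
cornerSign Y (_ , sy , _) = sy
cornerSign Z (_ , _ , sz) = sz

cornerLevel : Axis → Axis → Level
cornerLevel a b = if does (a ≟ₐ b) then face else edge

symCorner : CornerSticker → SymPoint
symCorner ((sx , sy , sz) , a) = (sx , cornerLevel a X) , (sy , cornerLevel a Y) , (sz , cornerLevel a Z)

symCentre : Corner → SymPoint
symCentre (sx , sy , sz) = (sx , edge) , (sy , edge) , (sz , edge)

signs : SymPoint → Corner
signs ((sx , _) , (sy , _) , (sz , _)) = sx , sy , sz

faceAxis : SymPoint → Axis
faceAxis ((_ , face) , _ , _) = X
faceAxis (_ , (_ , face) , _) = Y
faceAxis _                    = Z

toSticker : SymPoint → CornerSticker
toSticker p = signs p , faceAxis p

toSticker-symCorner : ∀ t → toSticker (symCorner t) ≡ t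
toSticker-symCorner = from-yes (∀-CornerSticker? λ t → toSticker (symCorner t) ≟ᵗ t)

clampˢ-symCorner : ∀ t → clampˢ (symCorner t) ≡ symCentre (cnr t)
clampˢ-symCorner = from-yes (∀-CornerSticker? λ t → clampˢ (symCorner t) ≟ᵖ symCentre (cnr t))

clampᶜ-symCorner : ∀ a t → clampᶜ (coordˢ a (symCorner t)) ≡ (cornerSign a (cnr t) , edge)
clampᶜ-symCorner = from-yes (∀-Axis? λ a → ∀-CornerSticker? λ t →
                               clampᶜ (coordˢ a (symCorner t)) ≟ᶜ (cornerSign a (cnr t) , edge))

cornerMove : OuterMove → CornerSticker → CornerSticker
cornerMove f = toSticker ∘ symMove f ∘ symCorner

symCorner-cornerMove : ∀ f t → symCorner (cornerMove f t) ≡ symMove f (symCorner t)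
symCorner-cornerMove = from-yes (∀-OuterMove? λ f → ∀-CornerSticker? λ t →
                                   symCorner (cornerMove f t) ≟ᵖ symMove f (symCorner t))

-- Corner twists

_·ₛ_ : Sign → Sign → Sign
pos ·ₛ s = s
neg ·ₛ s = flip s

handedness : Corner → Sign
handedness (sx , sy , sz) = sx ·ₛ (sy ·ₛ sz)

nextAxis : Sign → Axis → Axis
nextAxis pos X = Y
nextAxis pos Y = Z
nextAxis pos Z = X
nextAxis neg X = Z
nextAxis neg Y = X
nextAxis neg Z = Y

-- next goes round the three stickers of a corner in the same rotational sense at every
-- corner (X → Y → Z in a right-handed frame), so it commutes with every rotation of the cube.
next : CornerSticker → CornerSticker
next (c , a) = c , nextAxis (handedness c) a

next^ : Fin 3 → CornerSticker → CornerSticker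
next^ zero             = id
next^ (suc zero)       = next
next^ (suc (suc zero)) = next ∘ next

ori : CornerSticker → Fin 3
ori (c , Z) = zero
ori (c , a) = if does (nextAxis (handedness c) Z ≟ₐ a) then suc zero else suc (suc zero)

next^-ori : ∀ t → next^ (ori t) (cnr t , Z) ≡ t
next^-ori = from-yes (∀-CornerSticker? λ t → next^ (ori t) (cnr t , Z) ≟ᵗ t)

ori-next^ : ∀ k t → ori (next^ k t) ≡ k +₃ ori t
ori-next^ = from-yes (∀-Fin? λ k → ∀-CornerSticker? λ t → ori (next^ k t) Finₚ.≟ k +₃ ori t)

sticker-ext : ∀ {t t′} → cnr t ≡ cnr t′ → ori t ≡ ori t′ → t ≡ t′
sticker-ext {t} {t′} c≡ o≡ = begin
  t                            ≡⟨ next^-ori t ⟨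
  next^ (ori t) (cnr t , Z)    ≡⟨ cong₂ (λ k c → next^ k (c , Z)) o≡ c≡ ⟩
  next^ (ori t′) (cnr t′ , Z)  ≡⟨ next^-ori t′ ⟩
  t′                           ∎

Rigid : (CornerSticker → CornerSticker) → Set
Rigid f = ∀ t → f (next t) ≡ next (f t)

rigid-∘ : ∀ {f g} → Rigid f → Rigid g → Rigid (g ∘ f)
rigid-∘ {f} {g} rf rg t = trans (cong g (rf t)) (rg (f t))

rigid-next^ : ∀ {f} → Rigid f → ∀ k t → f (next^ k t) ≡ next^ k (f t)
rigid-next^ r zero             t = refl
rigid-next^ r (suc zero)       t = r t
rigid-next^ r (suc (suc zero)) t = trans (r (next t)) (cong next (r t))

rigid-decompose : ∀ {f} → Rigid f → ∀ t → f t ≡ next^ (ori t) (f (cnr t , Z))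
rigid-decompose {f} r t = trans (cong f (sym (next^-ori t))) (rigid-next^ r (ori t) (cnr t , Z))

rigid-ext : ∀ {f g} → Rigid f → Rigid g → (∀ c → f (c , Z) ≡ g (c , Z)) → f ≗ g
rigid-ext {f} {g} rf rg agree t = begin
  f t                            ≡⟨ rigid-decompose rf t ⟩
  next^ (ori t) (f (cnr t , Z))  ≡⟨ cong (next^ (ori t)) (agree (cnr t)) ⟩
  next^ (ori t) (g (cnr t , Z))  ≡⟨ rigid-decompose rg t ⟨
  g t                            ∎

twist : (CornerSticker → CornerSticker) → Corner → Fin 3
twist f c = ori (f (c , Z))

position : (CornerSticker → CornerSticker) → Corner → Corner
position f c = cnr (f (c , Z))

twist-∘ : ∀ {g} → Rigid g → ∀ f c → twist (g ∘ f) c ≡ twist f c +₃ twist g (position f c)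
twist-∘ {g} r f c = trans (cong ori (rigid-decompose r (f (c , Z))))
                          (ori-next^ (ori (f (c , Z))) (g (position f c , Z)))

PositionsFixed : (CornerSticker → CornerSticker) → Set
PositionsFixed f = ∀ t → cnr (f t) ≡ cnr t

twist-∘-fixed : ∀ {g} → Rigid g → ∀ f → PositionsFixed f →
                ∀ c → twist (g ∘ f) c ≡ twist f c +₃ twist g c
twist-∘-fixed {g} r f fixed c =
  trans (twist-∘ r f c) (cong (λ d → twist f c +₃ twist g d) (fixed (c , Z)))

-- The numbering follows `setup` below; the last corner is UBR.
corner : Fin 8 → Corner
corner 0F = pos , pos , pos
corner 1F = pos , neg , pos
corner 2F = pos , neg , neg
corner 3F = neg , pos , pos
corner 4F = neg , pos , neg
corner 5F = neg , neg , pos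
corner 6F = neg , neg , neg
corner 7F = pos , pos , neg

index : Corner → Fin 8
index (pos , pos , pos) = 0F
index (pos , neg , pos) = 1F
index (pos , neg , neg) = 2F
index (neg , pos , pos) = 3F
index (neg , pos , neg) = 4F
index (neg , neg , pos) = 5F
index (neg , neg , neg) = 6F
index (pos , pos , neg) = 7F

corner-index : ∀ c → corner (index c) ≡ c
corner-index = from-yes (∀-Corner? λ c → corner (index c) ≟ᵏ c)

index-corner : ∀ i → index (corner i) ≡ i
index-corner = from-yes (∀-Fin? λ i → index (corner i) Finₚ.≟ i)

sum-reindex : ∀ (π ψ : Corner → Corner) → (∀ c → ψ (π c) ≡ c) → (∀ c → π (ψ c) ≡ c) →
              ∀ h → sum (h ∘ π ∘ corner) ≡ sum (h ∘ corner)
sum-reindex π ψ ψ∘π π∘ψ h = begin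
  sum (h ∘ π ∘ corner)   ≡⟨ sum-cong-≗ (λ i → cong h (corner-index (π (corner i)))) ⟨
  sum (h ∘ corner ∘ πᶠ)  ≡⟨ sum-permute (h ∘ corner) (permutation πᶠ ψᶠ inv inv′) ⟨
  sum (h ∘ corner)       ∎
  where
  πᶠ ψᶠ : Fin 8 → Fin 8
  πᶠ = index ∘ π ∘ corner
  ψᶠ = index ∘ ψ ∘ corner
  through : ∀ (φ φ′ : Corner → Corner) → (∀ c → φ (φ′ c) ≡ c) →
            ∀ i → index (φ (corner (index (φ′ (corner i))))) ≡ i
  through φ φ′ φ∘φ′ i = begin
    index (φ (corner (index (φ′ (corner i))))) ≡⟨ cong (index ∘ φ) (corner-index _) ⟩
    index (φ (φ′ (corner i)))                 ≡⟨ cong index (φ∘φ′ _) ⟩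
    index (corner i)                          ≡⟨ index-corner i ⟩
    i                                         ∎
  inv : ∀ i → πᶠ (ψᶠ i) ≡ i
  inv = through π ψ π∘ψ
  inv′ : ∀ i → ψᶠ (πᶠ i) ≡ i
  inv′ = through ψ π ψ∘π

twistSum : (CornerSticker → CornerSticker) → Fin 3
twistSum f = sum (twist f ∘ corner)

twistSum-∘ : ∀ {g} → Rigid g → ∀ f (ψ : Corner → Corner) →
             (∀ c → ψ (position f c) ≡ c) → (∀ c → position f (ψ c) ≡ c) →
             twistSum (g ∘ f) ≡ twistSum f +₃ twistSum g
twistSum-∘ {g} r f ψ ψ∘π π∘ψ = begin
  twistSum (g ∘ f)
    ≡⟨ sum-cong-≗ (twist-∘ r f ∘ corner) ⟩
  sum (λ i → twist f (corner i) +₃ twist g (position f (corner i)))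
    ≡⟨ ∑-distrib-+ (twist f ∘ corner) (twist g ∘ position f ∘ corner) ⟩
  twistSum f +₃ sum (twist g ∘ position f ∘ corner)
    ≡⟨ cong (twistSum f +₃_) (sum-reindex (position f) ψ ψ∘π π∘ψ (twist g)) ⟩
  twistSum f +₃ twistSum g
    ∎

cornerMove-rigid : ∀ f → Rigid (cornerMove f)
cornerMove-rigid = from-yes (∀-OuterMove? λ f → ∀-CornerSticker? λ t →
                               cornerMove f (next t) ≟ᵗ next (cornerMove f t))

cornerMove-position-inverseˡ : ∀ f c → position (cornerMove (inverse f)) (position (cornerMove f) c) ≡ c
cornerMove-position-inverseˡ = from-yes (∀-OuterMove? λ f → ∀-Corner? λ c →
                                position (cornerMove (inverse f)) (position (cornerMove f) c) ≟ᵏ c)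

cornerMove-position-inverseʳ : ∀ f c → position (cornerMove f) (position (cornerMove (inverse f)) c) ≡ c
cornerMove-position-inverseʳ = from-yes (∀-OuterMove? λ f → ∀-Corner? λ c →
                                  position (cornerMove f) (position (cornerMove (inverse f)) c) ≟ᵏ c)

twistSum-cornerMove : ∀ f → twistSum (cornerMove f) ≡ zero
twistSum-cornerMove = from-yes (∀-OuterMove? λ f → twistSum (cornerMove f) Finₚ.≟ zero)

cornerRun : List OuterMove → CornerSticker → CornerSticker
cornerRun = run cornerMove

cornerRun-rigid : ∀ l → Rigid (cornerRun l)
cornerRun-rigid []      t = refl
cornerRun-rigid (f ∷ l) t = rigid-∘ (cornerMove-rigid f) (cornerRun-rigid l) t

twistSum-cornerRun : ∀ l → twistSum (cornerRun l) ≡ zero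
twistSum-cornerRun []      = refl
twistSum-cornerRun (f ∷ l) = begin
  twistSum (cornerRun l ∘ cornerMove f)
    ≡⟨ twistSum-∘ (cornerRun-rigid l) (cornerMove f) (position (cornerMove (inverse f)))
                  (cornerMove-position-inverseˡ f) (cornerMove-position-inverseʳ f) ⟩
  twistSum (cornerMove f) +₃ twistSum (cornerRun l)
    ≡⟨ cong₂ _+₃_ (twistSum-cornerMove f) (twistSum-cornerRun l) ⟩
  zero
    ∎

data GridClass : Set where
  low high mid : GridClass

∀-GridClass? : Exhaustible GridClass
∀-GridClass? P? = map′ (λ (p , q , r) → λ { low → p ; high → q ; mid → r })
                       (λ f → f low , f high , f mid) (P? low ×-dec P? high ×-dec P? mid)

atRim : GridClass → Bool
atRim low  = true
atRim high = true
atRim mid  = false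

symGrid : Bool → GridClass → SymCoord
symGrid b low  = neg , edge
symGrid b high = pos , edge
symGrid b mid  = pos , inner b

SymFacelet : Set
SymFacelet = Face × GridClass × GridClass

∀-SymFacelet? : Exhaustible SymFacelet
∀-SymFacelet? = ∀-×? (∀-×? ∀-Axis? ∀-Sign?) (∀-×? ∀-GridClass? ∀-GridClass?)

symFacelet : SymFacelet → SymPoint
symFacelet ((X , σ) , g , h) = (σ , face) , symGrid false g , symGrid true h
symFacelet ((Y , σ) , g , h) = symGrid false g , (σ , face) , symGrid true h
symFacelet ((Z , σ) , g , h) = symGrid false g , symGrid true h , (σ , face)

isCornerFacelet : SymFacelet → Bool
isCornerFacelet (_ , g , h) = atRim g ∧ atRim h

symFacelet-corner : ∀ φ → T (isCornerFacelet φ) → symCorner (toSticker (symFacelet φ)) ≡ symFacelet φ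
symFacelet-corner = from-yes (∀-SymFacelet? λ φ →
  T? (isCornerFacelet φ) →-dec (symCorner (toSticker (symFacelet φ)) ≟ᵖ symFacelet φ))

symFacelet-inner : ∀ φ → T (not (isCornerFacelet φ)) → T (hasInner (symFacelet φ))
symFacelet-inner = from-yes (∀-SymFacelet? λ φ →
  T? (not (isCornerFacelet φ)) →-dec T? (hasInner (symFacelet φ)))

-- Twisting two corners

FixesNonCorners : List OuterMove → Set
FixesNonCorners l = ∀ φ → T (not (isCornerFacelet φ)) → run symMove l (symFacelet φ) ≡ symFacelet φ

PureTwist : List OuterMove → Set
PureTwist l = PositionsFixed (cornerRun l) × FixesNonCorners l

pureTwist-[] : PureTwist []
pureTwist-[] = (λ _ → refl) , (λ _ _ → refl)

pureTwist-++ : ∀ {l l′} → PureTwist l → PureTwist l′ → PureTwist (l ++ l′)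
pureTwist-++ {l} {l′} (fixed , fixesNC) (fixed′ , fixesNC′) = positions , nonCorners
  where
  positions : PositionsFixed (cornerRun (l ++ l′))
  positions t = begin
    cnr (cornerRun (l ++ l′) t)         ≡⟨ cong cnr (run-++ cornerMove l l′ t) ⟩
    cnr (cornerRun l′ (cornerRun l t))  ≡⟨ fixed′ (cornerRun l t) ⟩
    cnr (cornerRun l t)                 ≡⟨ fixed t ⟩
    cnr t                               ∎
  nonCorners : FixesNonCorners (l ++ l′)
  nonCorners φ nc = begin
    run symMove (l ++ l′) (symFacelet φ)              ≡⟨ run-++ symMove l l′ (symFacelet φ) ⟩
    run symMove l′ (run symMove l (symFacelet φ))     ≡⟨ cong (run symMove l′) (fixesNC φ nc) ⟩
    run symMove l′ (symFacelet φ)                     ≡⟨ fixesNC′ φ nc ⟩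
    symFacelet φ                                      ∎

_^_ : List OuterMove → Fin 3 → List OuterMove
l ^ zero           = []
l ^ suc zero       = l
l ^ suc (suc zero) = l ++ l

pureTwist-^ : ∀ {l} → PureTwist l → ∀ k → PureTwist (l ^ k)
pureTwist-^     p zero             = pureTwist-[]
pureTwist-^     p (suc zero)       = p
pureTwist-^ {l} p (suc (suc zero)) = pureTwist-++ {l} {l} p p

concatⱽ : ∀ {k} → Vector (List OuterMove) k → List OuterMove
concatⱽ = Vector.foldr _++_ []

pureTwist-concat : ∀ {k} (ls : Vector (List OuterMove) k) → (∀ i → PureTwist (ls i)) →
                   PureTwist (concatⱽ ls)
pureTwist-concat {zero}  ls pure = pureTwist-[]
pureTwist-concat {suc k} ls pure = pureTwist-++ {ls zero} {concatⱽ (ls ∘ suc)}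
                                                (pure zero) (pureTwist-concat (ls ∘ suc) (pure ∘ suc))

twist-concat : ∀ {k} (ls : Vector (List OuterMove) k) → (∀ i → PureTwist (ls i)) →
               ∀ c → twist (cornerRun (concatⱽ ls)) c ≡ sum (λ i → twist (cornerRun (ls i)) c)
twist-concat {zero}  ls pure c = refl
twist-concat {suc k} ls pure c = begin
  twist (cornerRun (ls zero ++ rest)) c
    ≡⟨ cong ori (run-++ cornerMove (ls zero) rest (c , Z)) ⟩
  twist (cornerRun rest ∘ cornerRun (ls zero)) c
    ≡⟨ twist-∘-fixed (cornerRun-rigid rest) (cornerRun (ls zero)) (proj₁ (pure zero)) c ⟩
  twist (cornerRun (ls zero)) c +₃ twist (cornerRun rest) c
    ≡⟨ cong (twist (cornerRun (ls zero)) c +₃_) (twist-concat (ls ∘ suc) (pure ∘ suc) c) ⟩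
  sum (λ i → twist (cornerRun (ls i)) c)
    ∎
  where
  rest = concatⱽ (ls ∘ suc)

R L U D F : Face
R = X , pos
L = X , neg
U = Y , pos
D = Y , neg
F = Z , pos

cw ccw : Face → OuterMove
cw  (a , s) = a , s , false
ccw (a , s) = a , s , true

undo : List OuterMove → List OuterMove
undo = reverse ∘ map inverse

-- The commutator [(R'D'RD)², U]: inside the U layer (R'D'RD)² only twists the corner URF,
-- and outside it (R'D'RD)² is cancelled by its inverse, so URF and UBR are twisted in
-- opposite senses and every other sticker is fixed.
twistPair : List OuterMove
twistPair = R′D′RD ++ R′D′RD ++ cw U ∷ undo (R′D′RD ++ R′D′RD) ++ ccw U ∷ []
  where
  R′D′RD : List OuterMove
  R′D′RD = ccw R ∷ ccw D ∷ cw R ∷ cw D ∷ []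

-- Turns of L, D, F leave UBR in place and bring corner i to URF.
setup : Fin 7 → List OuterMove
setup 0F = []
setup 1F = ccw F ∷ []
setup 2F = ccw D ∷ ccw F ∷ []
setup 3F = cw F ∷ []
setup 4F = cw L ∷ cw F ∷ []
setup 5F = ccw L ∷ cw F ∷ []
setup 6F = ccw L ∷ ccw L ∷ cw F ∷ []

twistWord : Fin 7 → List OuterMove
twistWord i = setup i ++ twistPair ++ undo (setup i)

twistWord-pure : ∀ i → PureTwist (twistWord i)
twistWord-pure i = positions i , nonCorners i
  where
  positions : ∀ i → PositionsFixed (cornerRun (twistWord i))
  positions = from-yes (∀-Fin? λ i → ∀-CornerSticker? λ t → cnr (cornerRun (twistWord i) t) ≟ᵏ cnr t)
  nonCorners : ∀ i → FixesNonCorners (twistWord i)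
  nonCorners = from-yes (∀-Fin? λ i → ∀-SymFacelet? λ φ → T? (not (isCornerFacelet φ)) →-dec
                          (run symMove (twistWord i) (symFacelet φ) ≟ᵖ symFacelet φ))

twist-twistWord^ : ∀ i j k → twist (cornerRun (twistWord i ^ k)) (corner (inject₁ j)) ≡
                             (if does (i Fin.≟ j) then k else zero)
twist-twistWord^ = from-yes (∀-Fin? λ i → ∀-Fin? λ j → ∀-Fin? λ k →
  twist (cornerRun (twistWord i ^ k)) (corner (inject₁ j)) Fin.≟ (if does (i Fin.≟ j) then k else zero))

twistingWord : Z3^7 → List OuterMove
twistingWord v = concatⱽ (λ i → twistWord i ^ lookup v i)

twistWord^-pure : ∀ v i → PureTwist (twistWord i ^ lookup v i)
twistWord^-pure v i = pureTwist-^ (twistWord-pure i) (lookup v i)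

twistingWord-pure : ∀ v → PureTwist (twistingWord v)
twistingWord-pure v = pureTwist-concat (λ i → twistWord i ^ lookup v i) (twistWord^-pure v)

twist-twistingWord : ∀ v j → twist (cornerRun (twistingWord v)) (corner (inject₁ j)) ≡ lookup v j
twist-twistingWord v j = begin
  twist (cornerRun (twistingWord v)) (corner (inject₁ j))
    ≡⟨ twist-concat (λ i → twistWord i ^ lookup v i) (twistWord^-pure v) (corner (inject₁ j)) ⟩
  sum (λ i → twist (cornerRun (twistWord i ^ lookup v i)) (corner (inject₁ j)))
    ≡⟨ sum-cong-≗ (λ i → twist-twistWord^ i j (lookup v i)) ⟩
  sum (λ i → if does (i Fin.≟ j) then lookup v i else zero)
    ≡⟨ sum-δ j (lookup v) ⟩
  lookup v j ∎

∣signed∣ : ∀ σ v → ∣ signed σ v ∣ ≡ ∣ v ∣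
∣signed∣ pos v = refl
∣signed∣ neg v = ℤₚ.∣-i∣≡∣i∣ v

-signed : ∀ σ v → - signed σ v ≡ signed (flip σ) v
-signed pos v = refl
-signed neg v = ℤₚ.neg-involutive v

v3-cong : ∀ {a a′ b b′ c c′} → a ≡ a′ → b ≡ b′ → c ≡ c′ → v3 a b c ≡ v3 a′ b′ c′
v3-cong refl refl refl = refl

sgn : ℤ → Sign
sgn (+ _)    = pos
sgn -[1+ _ ] = neg

-- The n × n × n cube, n = m + 2

module Cube (m : ℕ) where

  n : ℕ
  n = suc (suc m)

  Inner : ℤ → Set
  Inner v = ∣ v ∣ < suc m

  Valuation : Set
  Valuation = Bool → ℤ

  Valid : Valuation → Set
  Valid ρ = ∀ b → Inner (ρ b)

  magnitude : Valuation → Level → ℤ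
  magnitude ρ face      = + n
  magnitude ρ edge      = + suc m
  magnitude ρ (inner b) = ρ b

  ⟦_⟧ᶜ : SymCoord → Valuation → ℤ
  ⟦ σ , l ⟧ᶜ ρ = signed σ (magnitude ρ l)

  ⟦_⟧ : SymPoint → Valuation → V3
  ⟦ cx , cy , cz ⟧ ρ = v3 (⟦ cx ⟧ᶜ ρ) (⟦ cy ⟧ᶜ ρ) (⟦ cz ⟧ᶜ ρ)

  inner-signed : ∀ σ {v} → Inner v → Inner (signed σ v)
  inner-signed σ {v} = subst (_< suc m) (sym (∣signed∣ σ v))

  inner≢edge : ∀ {v} → Inner v → ∀ σ → v ≢ signed σ (+ suc m)
  inner≢edge inside σ v≡ = ℕₚ.<⇒≢ inside (trans (cong ∣_∣ v≡) (∣signed∣ σ (+ suc m)))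

  clamp-face : ∀ σ → clamp n (signed σ (+ n)) ≡ signed σ (+ suc m)
  clamp-face pos rewrite dec-true (+ n ℤ.≤? + n) ℤₚ.≤-refl = refl
  clamp-face neg rewrite dec-true (-[1+ suc m ] ℤ.≤? -[1+ suc m ]) ℤₚ.≤-refl = refl

  clamp-edge : ∀ σ → clamp n (signed σ (+ suc m)) ≡ signed σ (+ suc m)
  clamp-edge pos rewrite dec-false (+ n ℤ.≤? + suc m) (λ { (+≤+ le) → ℕₚ.n≮n (suc m) le }) = refl
  clamp-edge neg rewrite dec-false (-[1+ m ] ℤ.≤? -[1+ suc m ]) (λ { (-≤- le) → ℕₚ.n≮n m le }) = refl

  clamp-inner : ∀ v → Inner v → clamp n v ≡ v
  clamp-inner (+ k) lt
    rewrite dec-false (+ n ℤ.≤? + k)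
                      (λ { (+≤+ le) → ℕₚ.<⇒≱ lt (ℕₚ.≤-trans (ℕₚ.n≤1+n (suc m)) le) })
    = refl
  clamp-inner -[1+ k ] lt
    rewrite dec-false (-[1+ k ] ℤ.≤? -[1+ suc m ])
                      (λ { (-≤- le) → ℕₚ.<⇒≱ lt (s≤s (ℕₚ.≤-trans (ℕₚ.n≤1+n m) le)) })
    = refl

  clamp-⟦⟧ᶜ : ∀ {ρ} → Valid ρ → ∀ c → clamp n (⟦ c ⟧ᶜ ρ) ≡ ⟦ clampᶜ c ⟧ᶜ ρ
  clamp-⟦⟧ᶜ valid (σ , face)    = clamp-face σ
  clamp-⟦⟧ᶜ valid (σ , edge)    = clamp-edge σ
  clamp-⟦⟧ᶜ valid (σ , inner b) = clamp-inner _ (inner-signed σ (valid b))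

  cubie-⟦⟧ : ∀ {ρ} → Valid ρ → ∀ p → cubie n (⟦ p ⟧ ρ) ≡ ⟦ clampˢ p ⟧ ρ
  cubie-⟦⟧ valid (cx , cy , cz) = v3-cong (clamp-⟦⟧ᶜ valid cx) (clamp-⟦⟧ᶜ valid cy) (clamp-⟦⟧ᶜ valid cz)

  clamp-inner-¬edge : ∀ {ρ} → Valid ρ → ∀ c → T (isInner c) → ∣ clamp n (⟦ c ⟧ᶜ ρ) ∣ ≢ suc m
  clamp-inner-¬edge {ρ} valid (σ , inner b) _ e =
    ℕₚ.<⇒≢ inside (trans (cong ∣_∣ (sym (clamp-inner (signed σ (ρ b)) inside))) e)
    where
    inside : Inner (signed σ (ρ b))
    inside = inner-signed σ (valid b)

  inner-¬corner : ∀ {ρ} → Valid ρ → ∀ p → T (hasInner p) → ¬ IsCorner n (cubie n (⟦ p ⟧ ρ))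
  inner-¬corner valid (cx , cy , cz) h (ex , ey , ez) with Equivalence.to (Boolₚ.T-∨ {isInner cx}) h
  ... | inj₁ ix = clamp-inner-¬edge valid cx ix ex
  ... | inj₂ iyz with Equivalence.to (Boolₚ.T-∨ {isInner cy}) iyz
  ...   | inj₁ iy = clamp-inner-¬edge valid cy iy ey
  ...   | inj₂ iz = clamp-inner-¬edge valid cz iz ez

  sliceCoord-outer : ∀ s → sliceCoord n s 1 ≡ signed s (+ suc m)
  sliceCoord-outer pos = cong +_ (ℕₚ.+-comm m 1)
  sliceCoord-outer neg = cong (-_ ∘ +_) (ℕₚ.+-comm m 1)

  sliceCoord-inner : ∀ s k → 2 ℕ.* suc (suc k) ≤ n → Inner (sliceCoord n s (suc (suc k)))
  sliceCoord-inner s k le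
    rewrite ∣signed∣ s (+ (n ℕ.+ 1) ℤ.- + (2 ℕ.* suc (suc k)))
          | ℤₚ.[+m]-[+n]≡m⊖n (n ℕ.+ 1) (2 ℕ.* suc (suc k))
          | ℤₚ.⊖-≥ (ℕₚ.≤-trans le (ℕₚ.m≤m+n n 1))
          | ℕₚ.+-comm m 1
    = s≤s (ℕₚ.≤-trans (ℕₚ.∸-monoʳ-≤ (3 ℕ.+ m) four≤) (ℕₚ.m∸n≤m m 1))
    where
    four≤ : 4 ≤ 2 ℕ.* suc (suc k)
    four≤ = s≤s (s≤s (ℕₚ.≤-trans (ℕₚ.m≤m+n 2 (k ℕ.+ 0)) (ℕₚ.m≤n+m _ k)))

  edge-≟ : ∀ σ s → does (signed σ (+ suc m) ℤ.≟ signed s (+ suc m)) ≡ does (σ ≟ₛ s)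
  edge-≟ pos pos = dec-true (+ suc m ℤ.≟ + suc m) refl
  edge-≟ neg neg = dec-true (-[1+ m ] ℤ.≟ -[1+ m ]) refl
  edge-≟ pos neg = refl
  edge-≟ neg pos = refl

  inOuterLayer-correct : ∀ {ρ} → Valid ρ → ∀ s c →
                         does (clamp n (⟦ c ⟧ᶜ ρ) ℤ.≟ sliceCoord n s 1) ≡ inOuterLayer s c
  inOuterLayer-correct valid s (σ , face) rewrite clamp-face σ | sliceCoord-outer s = edge-≟ σ s
  inOuterLayer-correct valid s (σ , edge) rewrite clamp-edge σ | sliceCoord-outer s = edge-≟ σ s
  inOuterLayer-correct {ρ} valid s (σ , inner b)
    rewrite clamp-inner (signed σ (ρ b)) (inner-signed σ (valid b)) | sliceCoord-outer s
    = dec-false (signed σ (ρ b) ℤ.≟ signed s (+ suc m)) (inner≢edge (inner-signed σ (valid b)) s)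

  edge∉innerSlice : ∀ σ s k → 2 ℕ.* suc (suc k) ≤ n →
                    does (signed σ (+ suc m) ℤ.≟ sliceCoord n s (suc (suc k))) ≡ false
  edge∉innerSlice σ s k le = dec-false (signed σ (+ suc m) ℤ.≟ sliceCoord n s (suc (suc k)))
                                       (inner≢edge (sliceCoord-inner s k le) σ ∘ sym)

  ⟦⟧-negᶜ : ∀ ρ c → - ⟦ c ⟧ᶜ ρ ≡ ⟦ negᶜ c ⟧ᶜ ρ
  ⟦⟧-negᶜ ρ (σ , l) = -signed σ (magnitude ρ l)

  ⟦⟧-rot : ∀ ρ a p → rot a (⟦ p ⟧ ρ) ≡ ⟦ symRot a p ⟧ ρ
  ⟦⟧-rot ρ X (cx , cy , cz) = v3-cong refl (⟦⟧-negᶜ ρ cz) refl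
  ⟦⟧-rot ρ Y (cx , cy , cz) = v3-cong refl refl (⟦⟧-negᶜ ρ cx)
  ⟦⟧-rot ρ Z (cx , cy , cz) = v3-cong (⟦⟧-negᶜ ρ cy) refl refl

  ⟦⟧-rot⁻¹ : ∀ ρ a p → rot⁻¹ a (⟦ p ⟧ ρ) ≡ ⟦ symRot⁻¹ a p ⟧ ρ
  ⟦⟧-rot⁻¹ ρ a p = begin
    rot a (rot a (rot a (⟦ p ⟧ ρ)))      ≡⟨ cong (rot a ∘ rot a) (⟦⟧-rot ρ a p) ⟩
    rot a (rot a (⟦ symRot a p ⟧ ρ))     ≡⟨ cong (rot a) (⟦⟧-rot ρ a _) ⟩
    rot a (⟦ symRot a (symRot a p) ⟧ ρ)  ≡⟨ ⟦⟧-rot ρ a _ ⟩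
    ⟦ symRot⁻¹ a p ⟧ ρ                   ∎

  ⟦⟧-turn : ∀ ρ a s b p → turn a s b (⟦ p ⟧ ρ) ≡ ⟦ symTurn a s b p ⟧ ρ
  ⟦⟧-turn ρ a pos false p = ⟦⟧-rot⁻¹ ρ a p
  ⟦⟧-turn ρ a pos true  p = ⟦⟧-rot ρ a p
  ⟦⟧-turn ρ a neg false p = ⟦⟧-rot ρ a p
  ⟦⟧-turn ρ a neg true  p = ⟦⟧-rot⁻¹ ρ a p

  ⟦⟧-coord : ∀ ρ a p → coord a (⟦ p ⟧ ρ) ≡ ⟦ coordˢ a p ⟧ᶜ ρ
  ⟦⟧-coord ρ X p = refl
  ⟦⟧-coord ρ Y p = refl
  ⟦⟧-coord ρ Z p = refl

  outerMove : OuterMove → Move n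
  outerMove (a , s , b) = mv a s 1 (s≤s z≤n) (s≤s (s≤s z≤n)) b

  ⟦⟧-move : ∀ {ρ} → Valid ρ → ∀ f p → applyMove n (outerMove f) (⟦ p ⟧ ρ) ≡ ⟦ symMove f p ⟧ ρ
  ⟦⟧-move {ρ} valid (a , s , b) p = begin
    applyMove n (outerMove (a , s , b)) (⟦ p ⟧ ρ)
      ≡⟨ cong (λ c → if c then turn a s b (⟦ p ⟧ ρ) else ⟦ p ⟧ ρ) inLayer ⟩
    (if inOuterLayer s (coordˢ a p) then turn a s b (⟦ p ⟧ ρ) else ⟦ p ⟧ ρ)
      ≡⟨ turnIf (inOuterLayer s (coordˢ a p)) ⟩
    ⟦ symMove (a , s , b) p ⟧ ρ ∎
    where
    inLayer : does (clamp n (coord a (⟦ p ⟧ ρ)) ℤ.≟ sliceCoord n s 1) ≡ inOuterLayer s (coordˢ a p)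
    inLayer = trans (cong (λ v → does (clamp n v ℤ.≟ sliceCoord n s 1)) (⟦⟧-coord ρ a p))
                    (inOuterLayer-correct valid s (coordˢ a p))
    turnIf : ∀ c → (if c then turn a s b (⟦ p ⟧ ρ) else ⟦ p ⟧ ρ) ≡
                   ⟦ if c then symTurn a s b p else p ⟧ ρ
    turnIf true  = ⟦⟧-turn ρ a s b p
    turnIf false = refl

  toWord : List OuterMove → Word n
  toWord []      = ε
  toWord (f ∷ l) = gen (outerMove f) · toWord l

  ⟦⟧-toWord : ∀ {ρ} → Valid ρ → ∀ l p → eval n (toWord l) (⟦ p ⟧ ρ) ≡ ⟦ run symMove l p ⟧ ρ
  ⟦⟧-toWord valid []      p = refl
  ⟦⟧-toWord valid (f ∷ l) p =
    trans (cong (eval n (toWord l)) (⟦⟧-move valid f p)) (⟦⟧-toWord valid l (symMove f p))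

  -- Corner stickers have no inner coordinate, so any valuation places them.
  ρ₀ : Valuation
  ρ₀ _ = + 0

  ρ₀-valid : Valid ρ₀
  ρ₀-valid _ = s≤s z≤n

  cornerPos : CornerSticker → V3
  cornerPos t = ⟦ symCorner t ⟧ ρ₀

  ⟦symCorner⟧ : ∀ ρ t → ⟦ symCorner t ⟧ ρ ≡ cornerPos t
  ⟦symCorner⟧ ρ (_ , X) = refl
  ⟦symCorner⟧ ρ (_ , Y) = refl
  ⟦symCorner⟧ ρ (_ , Z) = refl

  -- Inner slices never move corner stickers (applyMove-cornerPos).
  cornerMoves : Word n → List OuterMove
  cornerMoves ε                      = []
  cornerMoves (gen (mv a s 1 _ _ b)) = (a , s , b) ∷ []
  cornerMoves (gen _)                = []
  cornerMoves (u · v)                = cornerMoves u ++ cornerMoves v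

  cornerAction : Word n → CornerSticker → CornerSticker
  cornerAction w = cornerRun (cornerMoves w)

  cornerAction-toWord : ∀ l → cornerAction (toWord l) ≡ cornerRun l
  cornerAction-toWord l = cong cornerRun (cornerMoves-toWord l)
    where
    cornerMoves-toWord : ∀ l → cornerMoves (toWord l) ≡ l
    cornerMoves-toWord []                = refl
    cornerMoves-toWord ((a , s , b) ∷ l) = cong ((a , s , b) ∷_) (cornerMoves-toWord l)

  clamp-cornerPos : ∀ a t → clamp n (coord a (cornerPos t)) ≡ signed (cornerSign a (cnr t)) (+ suc m)
  clamp-cornerPos a t = begin
    clamp n (coord a (cornerPos t))            ≡⟨ cong (clamp n) (⟦⟧-coord ρ₀ a (symCorner t)) ⟩
    clamp n (⟦ coordˢ a (symCorner t) ⟧ᶜ ρ₀)   ≡⟨ clamp-⟦⟧ᶜ ρ₀-valid (coordˢ a (symCorner t)) ⟩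
    ⟦ clampᶜ (coordˢ a (symCorner t)) ⟧ᶜ ρ₀    ≡⟨ cong (λ c → ⟦ c ⟧ᶜ ρ₀) (clampᶜ-symCorner a t) ⟩
    signed (cornerSign a (cnr t)) (+ suc m)    ∎

  applyMove-cornerPos : ∀ mo t → applyMove n mo (cornerPos t) ≡ cornerPos (cornerAction (gen mo) t)
  applyMove-cornerPos (mv a s zero () _ _) t
  applyMove-cornerPos (mv a s (suc zero) _ _ b) t = begin
    applyMove n (outerMove (a , s , b)) (cornerPos t)
      ≡⟨ ⟦⟧-move ρ₀-valid (a , s , b) (symCorner t) ⟩
    ⟦ symMove (a , s , b) (symCorner t) ⟧ ρ₀
      ≡⟨ cong (λ p → ⟦ p ⟧ ρ₀) (symCorner-cornerMove (a , s , b) t) ⟨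
    cornerPos (cornerMove (a , s , b) t)
      ∎
  applyMove-cornerPos (mv a s (suc (suc k)) _ 2k≤n b) t =
    cong (λ c → if c then turn a s b (cornerPos t) else cornerPos t)
         (trans (cong (λ v → does (v ℤ.≟ sliceCoord n s (suc (suc k)))) (clamp-cornerPos a t))
                (edge∉innerSlice (cornerSign a (cnr t)) s k 2k≤n))

  eval-cornerPos : ∀ w t → eval n w (cornerPos t) ≡ cornerPos (cornerAction w t)
  eval-cornerPos ε        t = refl
  eval-cornerPos (gen mo) t = applyMove-cornerPos mo t
  eval-cornerPos (u · v)  t = begin
    eval n v (eval n u (cornerPos t))              ≡⟨ cong (eval n v) (eval-cornerPos u t) ⟩
    eval n v (cornerPos (cornerAction u t))        ≡⟨ eval-cornerPos v (cornerAction u t) ⟩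
    cornerPos (cornerAction v (cornerAction u t))
      ≡⟨ cong cornerPos (run-++ cornerMove (cornerMoves u) (cornerMoves v) t) ⟨
    cornerPos (cornerAction (u · v) t)             ∎

  decodeᶜ : ℤ → SymCoord
  decodeᶜ v = sgn v , (if does (∣ v ∣ ℕ.≟ n) then face else edge)

  decode : V3 → SymPoint
  decode p = decodeᶜ (x p) , decodeᶜ (y p) , decodeᶜ (z p)

  decode-face : ∀ σ → decodeᶜ (signed σ (+ n)) ≡ (σ , face)
  decode-face pos rewrite dec-true (n ℕ.≟ n) refl = refl
  decode-face neg rewrite dec-true (n ℕ.≟ n) refl = refl

  decode-edge : ∀ σ → decodeᶜ (signed σ (+ suc m)) ≡ (σ , edge)
  decode-edge pos rewrite dec-false (suc m ℕ.≟ n) (ℕₚ.1+n≢n ∘ sym) = refl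
  decode-edge neg rewrite dec-false (suc m ℕ.≟ n) (ℕₚ.1+n≢n ∘ sym) = refl

  decode-cornerPos : ∀ t → decode (cornerPos t) ≡ symCorner t
  decode-cornerPos ((sx , sy , sz) , X) rewrite decode-face sx | decode-edge sy | decode-edge sz = refl
  decode-cornerPos ((sx , sy , sz) , Y) rewrite decode-edge sx | decode-face sy | decode-edge sz = refl
  decode-cornerPos ((sx , sy , sz) , Z) rewrite decode-edge sx | decode-edge sy | decode-face sz = refl

  cornerPos-injective : ∀ {t t′} → cornerPos t ≡ cornerPos t′ → t ≡ t′
  cornerPos-injective {t} {t′} t≡ = begin
    t                                  ≡⟨ toSticker-symCorner t ⟨
    toSticker (symCorner t)            ≡⟨ cong toSticker (decode-cornerPos t) ⟨
    toSticker (decode (cornerPos t))   ≡⟨ cong (toSticker ∘ decode) t≡ ⟩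
    toSticker (decode (cornerPos t′))  ≡⟨ cong toSticker (decode-cornerPos t′) ⟩
    toSticker (symCorner t′)           ≡⟨ toSticker-symCorner t′ ⟩
    t′                                 ∎

  centre : Corner → V3
  centre c = ⟦ symCentre c ⟧ ρ₀

  decode-centre : ∀ c → decode (centre c) ≡ symCentre c
  decode-centre (sx , sy , sz) rewrite decode-edge sx | decode-edge sy | decode-edge sz = refl

  centre-injective : ∀ {c c′} → centre c ≡ centre c′ → c ≡ c′
  centre-injective {c@(_ , _ , _)} {c′@(_ , _ , _)} c≡ =
    cong signs (trans (sym (decode-centre c)) (trans (cong decode c≡) (decode-centre c′)))

  cubie-cornerPos : ∀ t → cubie n (cornerPos t) ≡ centre (cnr t)
  cubie-cornerPos t =
    trans (cubie-⟦⟧ ρ₀-valid (symCorner t)) (cong (λ p → ⟦ p ⟧ ρ₀) (clampˢ-symCorner t))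

  centre-isCorner : ∀ c → IsCorner n (centre c)
  centre-isCorner (sx , sy , sz) = ∣signed∣ sx (+ suc m) , ∣signed∣ sy (+ suc m) , ∣signed∣ sz (+ suc m)

  grid-last : ∀ (i : Fin n) → toℕ i ≡ suc m → grid n i ≡ + suc m
  grid-last i i≡ rewrite i≡
    | ℤₚ.[+m]-[+n]≡m⊖n (2 ℕ.* suc m) (suc m)
    | ℤₚ.⊖-≥ (ℕₚ.m≤m+n (suc m) (suc m ℕ.+ 0))
    | ℕₚ.m+n∸m≡n (suc m) (suc m ℕ.+ 0)
    | ℕₚ.+-identityʳ (suc m) = refl

  grid-inner : ∀ t → 0 < t → t < suc m → Inner (+ (2 ℕ.* t) ℤ.- + suc m)
  grid-inner t 0<t t<1+m rewrite ℤₚ.[+m]-[+n]≡m⊖n (2 ℕ.* t) (suc m) with suc m ℕ.≤? 2 ℕ.* t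
  ... | yes le rewrite ℤₚ.⊖-≥ le = ℕₚ.m<n+o⇒m∸n<o (2 ℕ.* t) (suc m) 2t<
    where
    2t< : 2 ℕ.* t < suc m ℕ.+ suc m
    2t< rewrite ℕₚ.+-identityʳ t = ℕₚ.+-mono-< t<1+m t<1+m
  ... | no nle rewrite ℤₚ.∣⊖∣-< (ℕₚ.≰⇒> nle) =
        ℕₚ.∸-monoʳ-< {suc m} {2 ℕ.* t} {0} (ℕₚ.<-≤-trans 0<t (ℕₚ.m≤m+n t (t ℕ.+ 0)))
                                         (ℕₚ.<⇒≤ (ℕₚ.≰⇒> nle))

  data GridView (i : Fin n) : Set where
    lowᵛ  : grid n i ≡ -[1+ m ] → GridView i
    highᵛ : grid n i ≡ + suc m → GridView i
    midᵛ  : Inner (grid n i) → GridView i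

  gridView : ∀ i → GridView i
  gridView zero = lowᵛ refl
  gridView (suc j) with toℕ (suc j) ℕ.≟ suc m
  ... | yes j≡ = highᵛ (grid-last (suc j) j≡)
  ... | no  j≢ = midᵛ (grid-inner (toℕ (suc j)) (s≤s z≤n)
                                  (ℕₚ.≤∧≢⇒< (ℕₚ.≤-pred (Finₚ.toℕ<n (suc j))) j≢))

  gridClass : ∀ {i} → GridView i → GridClass
  gridClass (lowᵛ _)  = low
  gridClass (highᵛ _) = high
  gridClass (midᵛ _)  = mid

  -- The unknown standing for a grid coordinate; it is never read at the rim, where 0 is a dummy.
  gridValue : ∀ {i} → GridView i → ℤ
  gridValue {i} (midᵛ _) = grid n i
  gridValue (lowᵛ _)     = + 0
  gridValue (highᵛ _)    = + 0

  gridValue-inner : ∀ {i} (v : GridView i) → Inner (gridValue v)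
  gridValue-inner (midᵛ inside) = inside
  gridValue-inner (lowᵛ _)      = s≤s z≤n
  gridValue-inner (highᵛ _)     = s≤s z≤n

  grid-sym : ∀ {i} (v : GridView i) {ρ} b → ρ b ≡ gridValue v →
             grid n i ≡ ⟦ symGrid b (gridClass v) ⟧ᶜ ρ
  grid-sym (lowᵛ i≡)  b _  = i≡
  grid-sym (highᵛ i≡) b _  = i≡
  grid-sym (midᵛ _)   b ρ≡ = sym ρ≡

  classify : Facelet n → SymFacelet
  classify (φ , i , j) = φ , gridClass (gridView i) , gridClass (gridView j)

  valuation : Facelet n → Valuation
  valuation (_ , i , j) false = gridValue (gridView i)
  valuation (_ , i , j) true  = gridValue (gridView j)

  valuation-valid : ∀ f → Valid (valuation f)
  valuation-valid (_ , i , j) false = gridValue-inner (gridView i)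
  valuation-valid (_ , i , j) true  = gridValue-inner (gridView j)

  posF-sym : ∀ f → posF n f ≡ ⟦ symFacelet (classify f) ⟧ (valuation f)
  posF-sym ((X , σ) , i , j) = v3-cong refl (grid-sym (gridView i) false refl) (grid-sym (gridView j) true refl)
  posF-sym ((Y , σ) , i , j) = v3-cong (grid-sym (gridView i) false refl) refl (grid-sym (gridView j) true refl)
  posF-sym ((Z , σ) , i , j) = v3-cong (grid-sym (gridView i) false refl) (grid-sym (gridView j) true refl) refl

  data FaceletView (f : Facelet n) : Set where
    cornerᵛ : ∀ t → posF n f ≡ cornerPos t → FaceletView f
    otherᵛ  : T (not (isCornerFacelet (classify f))) → FaceletView f

  faceletView : ∀ f → FaceletView f
  faceletView f with isCornerFacelet (classify f) in isCorner
  ... | false = otherᵛ (subst (T ∘ not) (sym isCorner) tt)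
  ... | true  = cornerᵛ t (begin
    posF n f                 ≡⟨ posF-sym f ⟩
    ⟦ symFacelet φ ⟧ ρ       ≡⟨ cong (λ p → ⟦ p ⟧ ρ) (symFacelet-corner φ (subst T (sym isCorner) tt)) ⟨
    ⟦ symCorner t ⟧ ρ        ≡⟨ ⟦symCorner⟧ ρ t ⟩
    cornerPos t              ∎)
    where
    φ = classify f
    ρ = valuation f
    t = toSticker (symFacelet φ)

  other-¬corner : ∀ f → T (not (isCornerFacelet (classify f))) → ¬ IsCorner n (cubie n (posF n f))
  other-¬corner f nc rewrite posF-sym f =
    inner-¬corner (valuation-valid f) (symFacelet (classify f)) (symFacelet-inner (classify f) nc)

  cornerIndex : Sign → Fin n
  cornerIndex pos = fromℕ (suc m)
  cornerIndex neg = zero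

  grid-cornerIndex : ∀ σ → grid n (cornerIndex σ) ≡ signed σ (+ suc m)
  grid-cornerIndex pos = grid-last (fromℕ (suc m)) (Finₚ.toℕ-fromℕ (suc m))
  grid-cornerIndex neg = refl

  cornerFacelet : CornerSticker → Facelet n
  cornerFacelet ((sx , sy , sz) , X) = (X , sx) , cornerIndex sy , cornerIndex sz
  cornerFacelet ((sx , sy , sz) , Y) = (Y , sy) , cornerIndex sx , cornerIndex sz
  cornerFacelet ((sx , sy , sz) , Z) = (Z , sz) , cornerIndex sx , cornerIndex sy

  posF-cornerFacelet : ∀ t → posF n (cornerFacelet t) ≡ cornerPos t
  posF-cornerFacelet ((sx , sy , sz) , X) = v3-cong refl (grid-cornerIndex sy) (grid-cornerIndex sz)
  posF-cornerFacelet ((sx , sy , sz) , Y) = v3-cong (grid-cornerIndex sx) refl (grid-cornerIndex sz)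
  posF-cornerFacelet ((sx , sy , sz) , Z) = v3-cong (grid-cornerIndex sx) (grid-cornerIndex sy) refl

  InOC-positionsFixed : ∀ w → InOC n w → PositionsFixed (cornerAction w)
  InOC-positionsFixed w (cubiesFixed , _) t = centre-injective (begin
    centre (cnr (cornerAction w t))         ≡⟨ cubie-cornerPos (cornerAction w t) ⟨
    cubie n (cornerPos (cornerAction w t))  ≡⟨ cong (cubie n) (eval-cornerPos w t) ⟨
    cubie n (eval n w (cornerPos t))        ≡⟨ subst (λ p → cubie n (eval n w p) ≡ cubie n p)
                                                      (posF-cornerFacelet t) (cubiesFixed (cornerFacelet t)) ⟩
    cubie n (cornerPos t)                   ≡⟨ cubie-cornerPos t ⟩
    centre (cnr t)                          ∎)

  ≈G-cornerAction : ∀ {u v} → u ≈G v → cornerAction u ≗ cornerAction v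
  ≈G-cornerAction {u} {v} u≈v t = cornerPos-injective (begin
    cornerPos (cornerAction u t)  ≡⟨ eval-cornerPos u t ⟨
    eval n u (cornerPos t)        ≡⟨ subst (λ p → eval n u p ≡ eval n v p)
                                           (posF-cornerFacelet t) (u≈v (cornerFacelet t)) ⟩
    eval n v (cornerPos t)        ≡⟨ eval-cornerPos v t ⟩
    cornerPos (cornerAction v t)  ∎)

  toWord-fixesNonCorners : ∀ l → FixesNonCorners l →
                           ∀ f → T (not (isCornerFacelet (classify f))) → eval n (toWord l) (posF n f) ≡ posF n f
  toWord-fixesNonCorners l fixes f nc = begin
    eval n (toWord l) (posF n f)            ≡⟨ cong (eval n (toWord l)) (posF-sym f) ⟩
    eval n (toWord l) (⟦ symFacelet φ ⟧ ρ)  ≡⟨ ⟦⟧-toWord (valuation-valid f) l (symFacelet φ) ⟩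
    ⟦ run symMove l (symFacelet φ) ⟧ ρ      ≡⟨ cong (λ p → ⟦ p ⟧ ρ) (fixes φ nc) ⟩
    ⟦ symFacelet φ ⟧ ρ                      ≡⟨ posF-sym f ⟨
    posF n f                                ∎
    where
    φ = classify f
    ρ = valuation f

  pureTwist-InOC : ∀ l → PureTwist l → InOC n (toWord l)
  pureTwist-InOC l (fixed , fixes) =
    (λ f → cubieFixed f (faceletView f)) , (λ f → nonCornerFixed f (faceletView f))
    where
    cubieFixed : ∀ f → FaceletView f → cubie n (eval n (toWord l) (posF n f)) ≡ cubie n (posF n f)
    cubieFixed f (otherᵛ nc)   = cong (cubie n) (toWord-fixesNonCorners l fixes f nc)
    cubieFixed f (cornerᵛ t e) rewrite e = begin
      cubie n (eval n (toWord l) (cornerPos t))        ≡⟨ cong (cubie n) (eval-cornerPos (toWord l) t) ⟩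
      cubie n (cornerPos (cornerAction (toWord l) t))  ≡⟨ cubie-cornerPos (cornerAction (toWord l) t) ⟩
      centre (cnr (cornerAction (toWord l) t))         ≡⟨ cong (λ g → centre (cnr (g t))) (cornerAction-toWord l) ⟩
      centre (cnr (cornerRun l t))                     ≡⟨ cong centre (fixed t) ⟩
      centre (cnr t)                                   ≡⟨ cubie-cornerPos t ⟨
      cubie n (cornerPos t)                            ∎

    nonCornerFixed : ∀ f → FaceletView f → ¬ IsCorner n (cubie n (posF n f)) →
                     eval n (toWord l) (posF n f) ≡ posF n f
    nonCornerFixed f (otherᵛ nc)   _       = toWord-fixesNonCorners l fixes f nc
    nonCornerFixed f (cornerᵛ t e) ¬corner = ⊥-elim (¬corner (subst (IsCorner n)
      (sym (trans (cong (cubie n) e) (cubie-cornerPos t))) (centre-isCorner (cnr t))))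

  twists : Word n → Vector (Fin 3) 8
  twists w = twist (cornerAction w) ∘ corner

  twists-· : ∀ u → InOC n u → ∀ v i → twists (u · v) i ≡ twists u i +₃ twists v i
  twists-· u inOC v i = begin
    twist (cornerAction (u · v)) (corner i)
      ≡⟨ cong ori (run-++ cornerMove (cornerMoves u) (cornerMoves v) (corner i , Z)) ⟩
    twist (cornerAction v ∘ cornerAction u) (corner i)
      ≡⟨ twist-∘-fixed (cornerRun-rigid (cornerMoves v)) (cornerAction u) (InOC-positionsFixed u inOC) (corner i) ⟩
    twists u i +₃ twists v i
      ∎

  -- The last corner, UBR, is left out: its twist is determined by the others.
  toZ3^7 : OC n → Z3^7
  toZ3^7 (w , _) = tabulate (init (twists w))

  fromZ3^7 : Z3^7 → OC n
  fromZ3^7 v = toWord (twistingWord v) , pureTwist-InOC (twistingWord v) (twistingWord-pure v)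

  to-cong : (g h : OC n) → proj₁ g ≈G proj₁ h → toZ3^7 g ≡ toZ3^7 h
  to-cong (u , _) (v , _) u≈v =
    Vecₚ.tabulate-cong (λ i → cong ori (≈G-cornerAction {u} {v} u≈v (corner (inject₁ i) , Z)))

  to-hom : (g h : OC n) (p : InOC n (proj₁ g · proj₁ h)) →
           toZ3^7 (proj₁ g · proj₁ h , p) ≡ toZ3^7 g ⊕ toZ3^7 h
  to-hom (u , inOC) (v , _) _ = begin
    tabulate (init (twists (u · v)))
      ≡⟨ Vecₚ.tabulate-cong (twists-· u inOC v ∘ inject₁) ⟩
    tabulate (λ i → twists u (inject₁ i) +₃ twists v (inject₁ i))
      ≡⟨ zipWith-tabulate _+₃_ (init (twists u)) (init (twists v)) ⟨
    tabulate (init (twists u)) ⊕ tabulate (init (twists v))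
      ∎

  to-from : (v : Z3^7) → toZ3^7 (fromZ3^7 v) ≡ v
  to-from v = begin
    tabulate (init (twists (toWord (twistingWord v))))  ≡⟨ Vecₚ.tabulate-cong twist≡ ⟩
    tabulate (lookup v)                                 ≡⟨ Vecₚ.tabulate∘lookup v ⟩
    v                                                   ∎
    where
    twist≡ : ∀ j → twists (toWord (twistingWord v)) (inject₁ j) ≡ lookup v j
    twist≡ j = trans (cong (λ g → twist g (corner (inject₁ j))) (cornerAction-toWord (twistingWord v)))
                     (twist-twistingWord v j)

  twists-determined : ∀ u w → init (twists u) ≗ init (twists w) → twists u ≗ twists w
  twists-determined u w init≗ = init-sum-≗ (twists u) (twists w) init≗
    (trans (twistSum-cornerRun (cornerMoves u)) (sym (twistSum-cornerRun (cornerMoves w))))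

  cornerAction-determined : ∀ u w → PositionsFixed (cornerAction u) → PositionsFixed (cornerAction w) →
                            twists u ≗ twists w → cornerAction u ≗ cornerAction w
  cornerAction-determined u w fixedᵘ fixedʷ twists≗ =
    rigid-ext (cornerRun-rigid (cornerMoves u)) (cornerRun-rigid (cornerMoves w)) λ c →
      sticker-ext (trans (fixedᵘ (c , Z)) (sym (fixedʷ (c , Z)))) (begin
        twist (cornerAction u) c  ≡⟨ cong (twist (cornerAction u)) (corner-index c) ⟨
        twists u (index c)        ≡⟨ twists≗ (index c) ⟩
        twists w (index c)        ≡⟨ cong (twist (cornerAction w)) (corner-index c) ⟩
        twist (cornerAction w) c  ∎)

  from-to : (g : OC n) → proj₁ (fromZ3^7 (toZ3^7 g)) ≈G proj₁ g
  from-to g@(w , inOC) f = byView (faceletView f)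
    where
    g′ : OC n
    g′ = fromZ3^7 (toZ3^7 g)
    w′ = proj₁ g′
    inOC′ = proj₂ g′

    init≗ : init (twists w′) ≗ init (twists w)
    init≗ j = begin
      init (twists w′) j        ≡⟨ Vecₚ.lookup∘tabulate (init (twists w′)) j ⟨
      lookup (toZ3^7 g′) j      ≡⟨ cong (λ v → lookup v j) (to-from (toZ3^7 g)) ⟩
      lookup (toZ3^7 g) j       ≡⟨ Vecₚ.lookup∘tabulate (init (twists w)) j ⟩
      init (twists w) j         ∎

    agree : cornerAction w′ ≗ cornerAction w
    agree = cornerAction-determined w′ w (InOC-positionsFixed w′ inOC′) (InOC-positionsFixed w inOC)
                                    (twists-determined w′ w init≗)

    byView : FaceletView f → eval n w′ (posF n f) ≡ eval n w (posF n f)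
    byView (otherᵛ nc)   = trans (proj₂ inOC′ f ¬corner) (sym (proj₂ inOC f ¬corner))
      where
      ¬corner = other-¬corner f nc
    byView (cornerᵛ t e) rewrite e = begin
      eval n w′ (cornerPos t)        ≡⟨ eval-cornerPos w′ t ⟩
      cornerPos (cornerAction w′ t)  ≡⟨ cong cornerPos (agree t) ⟩
      cornerPos (cornerAction w t)   ≡⟨ eval-cornerPos w t ⟨
      eval n w (cornerPos t)         ∎

  cornerTwists : OC≅Z3^7 n
  cornerTwists = record
    { to      = toZ3^7
    ; from    = fromZ3^7
    ; to-cong = to-cong
    ; to-hom  = to-hom
    ; from-to = from-to
    ; to-from = to-from
    }

theorem15 : (n : ℕ) → 2 ≤ n → OC≅Z3^7 n
theorem15 (suc zero)    (s≤s ())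
theorem15 (suc (suc m)) _ = Cube.cornerTwists m
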